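{- Let $f,g\in x+x^2\mathbb{C}[[x]]$ satisfy $p_s^f(\alpha)\,p_{1-s}^g(\alpha)=p_s^g(\alpha)\,p_{1-s}^f(\alpha)$ for all $s\in\mathbb{C}$. Then $$f'(x)+g''(0)f(x)=g'(x)+f''(0)g(x).$$
   Context: $x+x^2\mathbb{C}[[x]]$ is the set of formal power series with zero constant term and linear coefficient 1. For $f$ in this set and $s\in\mathbb{C}$, write $(x/f(x))^s=\sum_{n\ge0}q_n(s)x^n/n!$ and define the formal series $p_s^f(\alpha)=\sum_{n\ge0}\binom{s-1}{n}q_n(s)\alpha^{s-n}\in\alpha^s+\alpha^{s-1}\mathbb{C}[[\alpha^{ -1}]]$. -}

module Defs where

open import Level using (Level; _⊔_) renaming (suc to lsuc)
open import Data.Nat using (ℕ; zero; suc)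
open import Data.List using (List; []; _∷_)
open import Data.Product using (_×_)
open import Algebra.Bundles using (CommutativeRing)
open import Relation.Nullary using (¬_)

module Embed {c ℓ : Level} (R : CommutativeRing c ℓ) where
  open CommutativeRing R
  ι : ℕ → Carrier
  ι zero    = 0#
  ι (suc n) = 1# + ι n

record CharZeroField (c ℓ : Level) : Set (lsuc (c ⊔ ℓ)) where
  field
    commRing : CommutativeRing c ℓ
  open CommutativeRing commRing public
  open Embed commRing public
  field
    _⁻¹      : Carrier → Carrier
    0≉1      : ¬ (0# ≈ 1#)
    inverseʳ : ∀ x → ¬ (x ≈ 0#) → x * (x ⁻¹) ≈ 1#
    charZero : ∀ n → ¬ (ι (suc n) ≈ 0#)

module PowerSeries {c ℓ : Level} (K : CharZeroField c ℓ) where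
  open CharZeroField K

  Series : Set c
  Series = ℕ → Carrier

  Σ< : ℕ → (ℕ → Carrier) → Carrier
  Σ< zero    a = 0#
  Σ< (suc n) a = Σ< n a + a n

  Π< : ℕ → (ℕ → Carrier) → Carrier
  Π< zero    a = 1#
  Π< (suc n) a = Π< n a * a n

  _! : ℕ → ℕ
  zero !  = 1
  suc n ! = suc n Data.Nat.* (n !)

  binom : Carrier → ℕ → Carrier
  binom a n = Π< n (λ i → a - ι i) * (ι (n !)) ⁻¹

  _⊛_ : Series → Series → Series
  (a ⊛ b) n = Σ< (suc n) (λ i → a i * b (n Data.Nat.∸ i))

  one : Series
  one zero    = 1#
  one (suc n) = 0#

  _⊖_ : Series → Series → Series
  (a ⊖ b) n = a n - b n

  _^^_ : Series → ℕ → Series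
  a ^^ zero  = one
  a ^^ suc k = (a ^^ k) ⊛ a

  -- power (1 + t)^s = Σ_k binom(s,k) t^k for a series u = 1 + t with u 0 = 1
  -- (finite sum coefficientwise since t has zero constant term)
  cpow : Series → Carrier → Series
  cpow u s n = Σ< (suc n) (λ k → binom s k * ((u ⊖ one) ^^ k) n)

  -- multiplicative inverse of a series h with h 0 = 1:
  -- u 0 = 1, u n = - Σ_{k=1}^{n} h k * u (n - k)
  -- total list lookup (default 0#)
  at : List Carrier → ℕ → Carrier
  at []       j       = 0#
  at (x ∷ xs) zero    = x
  at (x ∷ xs) (suc j) = at xs j

  invList : Series → ℕ → List Carrier     -- (u n , u (n-1) , … , u 0)
  invList h zero    = 1# ∷ []
  invList h (suc n) = (- Σ< (suc n) (λ j → h (suc j) * at v j)) ∷ v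
    where
      v : List Carrier
      v = invList h n

  inv : Series → Series
  inv h n = at (invList h n) 0

  -- for f ∈ x + x²K[[x]]:  f(x)/x  and  x/f(x)
  divX : Series → Series
  divX f n = f (suc n)

  xOver : Series → Series
  xOver f = inv (divX f)

  -- (x/f(x))^s = Σ_n q_n(s) x^n / n!
  q : Series → Carrier → ℕ → Carrier
  q f s n = ι (n !) * cpow (xOver f) s n

  -- p_s^f(α) = Σ_n binom(s-1,n) q_n(s) α^(s-n); we record the coefficient of α^(s-n)
  p : Series → Carrier → ℕ → Carrier
  p f s n = binom (s - 1#) n * q f s n

  -- coefficient of α^(1-k) in  p_s^f(α) · p_{1-s}^g(α)
  pp : Series → Series → Carrier → ℕ → Carrier
  pp f g s k = Σ< (suc k) (λ n → p f s n * p g (1# - s) (k Data.Nat.∸ n))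

  deriv : Series → Series
  deriv f n = ι (suc n) * f (suc n)

  Normalized : Series → Set ℓ
  Normalized f = (f 0 ≈ 0#) × (f 1 ≈ 1#)

module Submission where

-- Only the single value s = 2
-- is needed.  There 1 - s = -1, and
--   * p_2^f(α) = α² - 2 f₂ α is a polynomial, since binom(1, n) = 0 for n ≥ 2
--     and (x/f)^2 = 1 - 2 f₂ x + ⋯ ;
--   * (x/g)^{-1} = g/x, so p_{-1}^g(α) = Σ_m ρ_m g_{m+1} α^{-1-m} with
--     ρ_m = m! binom(-2, m) ≠ 0 (characteristic zero).
-- Hence the coefficient of α^{-k} in p_2^f p_{-1}^g is
-- -ρ_k ((k+2) g_{k+2} + 2 f₂ g_{k+1}); comparing with the symmetric product
-- and cancelling ρ_k gives (k+2) f_{k+2} + 2 g₂ f_{k+1} = (k+2) g_{k+2} + 2 f₂ g_{k+1},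
-- which is the coefficient of x^{k+1} in f' + g''(0) f = g' + f''(0) g.

open import Level using (Level)
open import Data.Nat as ℕ using (ℕ; zero; suc; _∸_; s≤s)
open import Data.Nat.Induction using (<-rec)
import Data.Nat.Properties as ℕₚ
open import Function using (_∘_)
open import Data.Product using (_,_) renaming (_×_ to _⊗_)
open import Data.Product.Properties using (≡-dec)
open import Data.Maybe using (Maybe; just; nothing)
open import Relation.Nullary using (yes; no; ¬_)
open import Data.Sum using (inj₁; inj₂)
open import Relation.Binary.PropositionalEquality as ≡ using (_≡_)
open import Algebra.Bundles using (CommutativeRing; RawRing)
open import Algebra.Solver.Ring.AlmostCommutativeRing
  using (_-Raw-AlmostCommutative⟶_; fromCommutativeRing)
import Algebra.Solver.Ring
open import Defs

-- A ring solver for an arbitrary commutative ring whose constants are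
-- integers, represented as differences a - b of natural numbers.  Pairs
-- are kept in the normal form (a ∸ b , b ∸ a), so that closed integer
-- constants compare by definitional equality.
module IntegerCoefficientSolver {c ℓ : Level} (R : CommutativeRing c ℓ) where
  open CommutativeRing R
  open Embed R using (ι)
  open import Relation.Binary.Reasoning.Setoid setoid
  open import Algebra.Properties.Ring ring using (-0#≈0#; -‿+-comm; ⁻¹-anti-homo‿-; x[y-z]≈xy-xz; [y-z]x≈yx-zx)
  open import Algebra.Properties.CommutativeSemigroup +-commutativeSemigroup using (interchange)
  open import Algebra.Properties.Semiring.Mult semiring using (_×_; ×-homo-+; ×1-homo-*)

  ι≈× : ∀ n → ι n ≈ n × 1#
  ι≈× zero    = refl
  ι≈× (suc n) = +-congˡ (ι≈× n)

  ι-+ : ∀ m n → ι (m ℕ.+ n) ≈ ι m + ι n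
  ι-+ m n = trans (ι≈× (m ℕ.+ n))
    (trans (×-homo-+ 1# m n) (sym (+-cong (ι≈× m) (ι≈× n))))

  ι-* : ∀ m n → ι (m ℕ.* n) ≈ ι m * ι n
  ι-* m n = trans (ι≈× (m ℕ.* n))
    (trans (×1-homo-* m n) (sym (*-cong (ι≈× m) (ι≈× n))))

  sub-+ : ∀ x y z w → (x + z) - (y + w) ≈ (x - y) + (z - w)
  sub-+ x y z w = begin
    (x + z) - (y + w)   ≈⟨ +-congˡ (sym (-‿+-comm y w)) ⟩
    (x + z) + (- y - w) ≈⟨ interchange x z (- y) (- w) ⟩
    (x - y) + (z - w)   ∎

  sub-* : ∀ x y z w → (x * z + y * w) - (x * w + y * z) ≈ (x - y) * (z - w)
  sub-* x y z w = sym (begin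
    (x - y) * (z - w)                 ≈⟨ x[y-z]≈xy-xz (x - y) z w ⟩
    (x - y) * z - (x - y) * w         ≈⟨ +-cong ([y-z]x≈yx-zx z x y) (-‿cong ([y-z]x≈yx-zx w x y)) ⟩
    (x * z - y * z) - (x * w - y * w) ≈⟨ +-congˡ (⁻¹-anti-homo‿- (x * w) (y * w)) ⟩
    (x * z - y * z) + (y * w - x * w) ≈⟨ sym (sub-+ (x * z) (y * z) (y * w) (x * w)) ⟩
    (x * z + y * w) - (y * z + x * w) ≈⟨ +-congˡ (-‿cong (+-comm (y * z) (x * w))) ⟩
    (x * z + y * w) - (x * w + y * z) ∎)

  ℤ² : Set
  ℤ² = ℕ ⊗ ℕ

  canonical : ℤ² → ℤ²
  canonical (a , b) = (a ∸ b , b ∸ a)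

  -- Numerals without a trailing 0#, e.g. numeral 2 = 1# + 1#.
  numeral : ℕ → Carrier
  numeral zero          = 0#
  numeral (suc zero)    = 1#
  numeral (suc (suc n)) = 1# + numeral (suc n)

  -- Closed constants evaluate to
  -- the natural notation (e.g. (2 , 0) to 1# + 1#), so goals stated with
  -- such numerals are matched definitionally by the solver.
  ⟦_⟧ᶻ : ℤ² → Carrier
  ⟦ a , zero ⟧ᶻ        = numeral a
  ⟦ zero , suc b ⟧ᶻ    = - numeral (suc b)
  ⟦ suc a , suc b ⟧ᶻ   = ⟦ a , b ⟧ᶻ

  numeral≈ι : ∀ n → numeral n ≈ ι n
  numeral≈ι zero          = refl
  numeral≈ι (suc zero)    = sym (+-identityʳ 1#)
  numeral≈ι (suc (suc n)) = +-congˡ (numeral≈ι (suc n))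

  x-0≈x : ∀ x → x - 0# ≈ x
  x-0≈x x = trans (+-congˡ -0#≈0#) (+-identityʳ x)

  difference-suc : ∀ a b → ι (suc a) - ι (suc b) ≈ ι a - ι b
  difference-suc a b = begin
    (1# + ι a) - (1# + ι b) ≈⟨ sub-+ 1# 1# (ι a) (ι b) ⟩
    (1# - 1#) + (ι a - ι b) ≈⟨ +-congʳ (-‿inverseʳ 1#) ⟩
    0# + (ι a - ι b)        ≈⟨ +-identityˡ _ ⟩
    ι a - ι b               ∎

  ⟦⟧ᶻ-difference : ∀ a b → ⟦ a , b ⟧ᶻ ≈ ι a - ι b
  ⟦⟧ᶻ-difference a       zero    = trans (numeral≈ι a) (sym (x-0≈x (ι a)))
  ⟦⟧ᶻ-difference zero    (suc b) = trans (-‿cong (numeral≈ι (suc b))) (sym (+-identityˡ _))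
  ⟦⟧ᶻ-difference (suc a) (suc b) = trans (⟦⟧ᶻ-difference a b) (sym (difference-suc a b))

  canonical-sound : ∀ a b → ⟦ canonical (a , b) ⟧ᶻ ≈ ι a - ι b
  canonical-sound zero    zero    = ⟦⟧ᶻ-difference 0 0
  canonical-sound zero    (suc b) = ⟦⟧ᶻ-difference 0 (suc b)
  canonical-sound (suc a) zero    = ⟦⟧ᶻ-difference (suc a) 0
  canonical-sound (suc a) (suc b) = trans (canonical-sound a b) (sym (difference-suc a b))

  coefficients : RawRing _ _
  coefficients = record
    { Carrier = ℤ² ; _≈_ = _≡_
    ; _+_ = λ { (a , b) (c , d) → canonical (a ℕ.+ c , b ℕ.+ d) }
    ; _*_ = λ { (a , b) (c , d) → canonical (a ℕ.* c ℕ.+ b ℕ.* d , a ℕ.* d ℕ.+ b ℕ.* c) }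
    ; -_ = λ { (a , b) → (b , a) }
    ; 0# = (0 , 0) ; 1# = (1 , 0) }

  interpretation : coefficients -Raw-AlmostCommutative⟶ fromCommutativeRing R
  interpretation = record
    { ⟦_⟧ = ⟦_⟧ᶻ
    ; +-homo = λ { (a , b) (c , d) → begin
        ⟦ canonical (a ℕ.+ c , b ℕ.+ d) ⟧ᶻ ≈⟨ canonical-sound (a ℕ.+ c) (b ℕ.+ d) ⟩
        ι (a ℕ.+ c) - ι (b ℕ.+ d)         ≈⟨ +-cong (ι-+ a c) (-‿cong (ι-+ b d)) ⟩
        (ι a + ι c) - (ι b + ι d)         ≈⟨ sub-+ (ι a) (ι b) (ι c) (ι d) ⟩
        (ι a - ι b) + (ι c - ι d)         ≈⟨ sym (+-cong (⟦⟧ᶻ-difference a b) (⟦⟧ᶻ-difference c d)) ⟩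
        ⟦ a , b ⟧ᶻ + ⟦ c , d ⟧ᶻ           ∎ }
    ; *-homo = λ { (a , b) (c , d) → begin
        ⟦ canonical (a ℕ.* c ℕ.+ b ℕ.* d , a ℕ.* d ℕ.+ b ℕ.* c) ⟧ᶻ
          ≈⟨ canonical-sound (a ℕ.* c ℕ.+ b ℕ.* d) (a ℕ.* d ℕ.+ b ℕ.* c) ⟩
        ι (a ℕ.* c ℕ.+ b ℕ.* d) - ι (a ℕ.* d ℕ.+ b ℕ.* c)
          ≈⟨ +-cong (trans (ι-+ (a ℕ.* c) (b ℕ.* d)) (+-cong (ι-* a c) (ι-* b d)))
                    (-‿cong (trans (ι-+ (a ℕ.* d) (b ℕ.* c)) (+-cong (ι-* a d) (ι-* b c)))) ⟩
        (ι a * ι c + ι b * ι d) - (ι a * ι d + ι b * ι c)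
          ≈⟨ sub-* (ι a) (ι b) (ι c) (ι d) ⟩
        (ι a - ι b) * (ι c - ι d)
          ≈⟨ sym (*-cong (⟦⟧ᶻ-difference a b) (⟦⟧ᶻ-difference c d)) ⟩
        ⟦ a , b ⟧ᶻ * ⟦ c , d ⟧ᶻ ∎ }
    ; -‿homo = λ { (a , b) → begin
        ⟦ b , a ⟧ᶻ   ≈⟨ ⟦⟧ᶻ-difference b a ⟩
        ι b - ι a    ≈⟨ sym (⁻¹-anti-homo‿- (ι a) (ι b)) ⟩
        - (ι a - ι b) ≈⟨ -‿cong (sym (⟦⟧ᶻ-difference a b)) ⟩
        - ⟦ a , b ⟧ᶻ ∎ }
    ; 0-homo = refl
    ; 1-homo = refl
    }

  equal? : ∀ p q → Maybe (⟦ p ⟧ᶻ ≈ ⟦ q ⟧ᶻ)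
  equal? p q with ≡-dec ℕ._≟_ ℕ._≟_ p q
  ... | yes ≡.refl = just refl
  ... | no _       = nothing

  open Algebra.Solver.Ring coefficients (fromCommutativeRing R) interpretation equal? public

  κ : ∀ {k} → ℕ → Polynomial k
  κ n = con (n , 0)

module Proof {c ℓ : Level} (K : CharZeroField c ℓ) where
  open CharZeroField K
  open PowerSeries K
  open import Relation.Binary.Reasoning.Setoid setoid
  open import Algebra.Properties.Ring ring
    using (-‿involutive; -0#≈0#; -‿injective; +-cancelˡ; -‿distribˡ-*; -‿+-comm)
  open import Algebra.Properties.CommutativeSemigroup +-commutativeSemigroup using (interchange)
  open IntegerCoefficientSolver commRing using (solve; _:+_; _:*_; :-_; _:-_; _:=_; κ; ι-*)

  Σ-cong : ∀ n {a b : ℕ → Carrier} → (∀ i → i ℕ.< n → a i ≈ b i) → Σ< n a ≈ Σ< n b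
  Σ-cong zero    eq = refl
  Σ-cong (suc n) eq = +-cong (Σ-cong n (λ i i<n → eq i (ℕₚ.m<n⇒m<1+n i<n))) (eq n ℕₚ.≤-refl)

  Σ-zero : ∀ n {a : ℕ → Carrier} → (∀ i → i ℕ.< n → a i ≈ 0#) → Σ< n a ≈ 0#
  Σ-zero n eq = trans (Σ-cong n eq) (sum-of-zeros n)
    where
    sum-of-zeros : ∀ n → Σ< n (λ _ → 0#) ≈ 0#
    sum-of-zeros zero    = refl
    sum-of-zeros (suc n) = trans (+-identityʳ _) (sum-of-zeros n)

  Σ-head : ∀ n (a : ℕ → Carrier) → Σ< (suc n) a ≈ a 0 + Σ< n (a ∘ suc)
  Σ-head zero    a = trans (+-identityˡ _) (sym (+-identityʳ _))
  Σ-head (suc n) a = trans (+-congʳ (Σ-head n a)) (+-assoc _ _ _)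

  Σ-+ : ∀ n (a b : ℕ → Carrier) → Σ< n (λ i → a i + b i) ≈ Σ< n a + Σ< n b
  Σ-+ zero    a b = sym (+-identityˡ _)
  Σ-+ (suc n) a b = trans (+-congʳ (Σ-+ n a b)) (interchange _ _ _ _)

  Σ-*ˡ : ∀ n x (a : ℕ → Carrier) → x * Σ< n a ≈ Σ< n (λ i → x * a i)
  Σ-*ˡ zero    x a = zeroʳ x
  Σ-*ˡ (suc n) x a = trans (distribˡ _ _ _) (+-congʳ (Σ-*ˡ n x a))

  Σ-*ʳ : ∀ n x (a : ℕ → Carrier) → Σ< n a * x ≈ Σ< n (λ i → a i * x)
  Σ-*ʳ zero    x a = zeroˡ x
  Σ-*ʳ (suc n) x a = trans (distribʳ _ _ _) (+-congʳ (Σ-*ʳ n x a))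

  Σ-neg : ∀ n (a : ℕ → Carrier) → - Σ< n a ≈ Σ< n (λ i → - a i)
  Σ-neg zero    a = -0#≈0#
  Σ-neg (suc n) a = trans (sym (-‿+-comm _ _)) (+-congʳ (Σ-neg n a))

  Σ-swap : ∀ m n (F : ℕ → ℕ → Carrier) →
           Σ< m (λ i → Σ< n (F i)) ≈ Σ< n (λ k → Σ< m (λ i → F i k))
  Σ-swap zero    n F = sym (Σ-zero n (λ _ _ → refl))
  Σ-swap (suc m) n F = trans (+-congʳ (Σ-swap m n F)) (sym (Σ-+ n _ _))

  Σ-extend : ∀ {m N} (a : ℕ → Carrier) → m ℕ.≤ N → (∀ k → m ℕ.≤ k → a k ≈ 0#) → Σ< N a ≈ Σ< m a
  Σ-extend {m} a m≤N vanish = go (ℕₚ.≤⇒≤′ m≤N)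
    where
    go : ∀ {N} → m ℕ.≤′ N → Σ< N a ≈ Σ< m a
    go (ℕ.≤′-reflexive ≡.refl) = refl
    go (ℕ.≤′-step m≤′N)        = trans (+-cong (go m≤′N) (vanish _ (ℕₚ.≤′⇒≤ m≤′N))) (+-identityʳ _)

  Π-cong : ∀ n {a b : ℕ → Carrier} → (∀ i → a i ≈ b i) → Π< n a ≈ Π< n b
  Π-cong zero    eq = refl
  Π-cong (suc n) eq = *-cong (Π-cong n eq) (eq n)

  Π-zero : ∀ n (a : ℕ → Carrier) j → j ℕ.< n → a j ≈ 0# → Π< n a ≈ 0#
  Π-zero (suc n) a j j<1+n aj≈0 with ℕₚ.m<1+n⇒m<n∨m≡n j<1+n
  ... | inj₁ j<n    = trans (*-congʳ (Π-zero n a j j<n aj≈0)) (zeroˡ _)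
  ... | inj₂ ≡.refl = trans (*-congˡ aj≈0) (zeroʳ _)

  *-cancelʳ : ∀ {x y z} → ¬ (z ≈ 0#) → x * z ≈ y * z → x ≈ y
  *-cancelʳ {x} {y} {z} z≉0 xz≈yz = begin
    x                 ≈⟨ unit x ⟩
    (x * z) * z ⁻¹    ≈⟨ *-congʳ xz≈yz ⟩
    (y * z) * z ⁻¹    ≈⟨ sym (unit y) ⟩
    y                 ∎
    where
    unit : ∀ w → w ≈ (w * z) * z ⁻¹
    unit w = sym (trans (*-assoc w z (z ⁻¹)) (trans (*-congˡ (inverseʳ z z≉0)) (*-identityʳ w)))

  *-cancelˡ : ∀ {x y z} → ¬ (z ≈ 0#) → z * x ≈ z * y → x ≈ y
  *-cancelˡ z≉0 zx≈zy = *-cancelʳ z≉0 (trans (*-comm _ _) (trans zx≈zy (*-comm _ _)))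

  *-nonzero : ∀ {x y} → ¬ (x ≈ 0#) → ¬ (y ≈ 0#) → ¬ (x * y ≈ 0#)
  *-nonzero x≉0 y≉0 xy≈0 = x≉0 (*-cancelʳ y≉0 (trans xy≈0 (sym (zeroˡ _))))

  Π-nonzero : ∀ n (a : ℕ → Carrier) → (∀ i → ¬ (a i ≈ 0#)) → ¬ (Π< n a ≈ 0#)
  Π-nonzero zero    a nonzero 1≈0 = 0≉1 (sym 1≈0)
  Π-nonzero (suc n) a nonzero     = *-nonzero (Π-nonzero n a nonzero) (nonzero n)

  ι-factorial-nonzero : ∀ k → ¬ (ι (k !) ≈ 0#)
  ι-factorial-nonzero zero    = charZero 0
  ι-factorial-nonzero (suc k) ιk!≈0 =
    *-nonzero (charZero k) (ι-factorial-nonzero k) (trans (sym (ι-* (suc k) (k !))) ιk!≈0)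

  falling : Carrier → ℕ → Carrier
  falling x k = Π< k (λ i → x - ι i)

  binom-factorial : ∀ x k → binom x k * ι (k !) ≈ falling x k
  binom-factorial x k = begin
    (falling x k * ι (k !) ⁻¹) * ι (k !) ≈⟨ *-assoc _ _ _ ⟩
    falling x k * (ι (k !) ⁻¹ * ι (k !)) ≈⟨ *-congˡ (trans (*-comm _ _) (inverseʳ _ (ι-factorial-nonzero k))) ⟩
    falling x k * 1#                     ≈⟨ *-identityʳ _ ⟩
    falling x k                          ∎

  binom-unique : ∀ x k {b} → b * ι (k !) ≈ falling x k → b ≈ binom x k
  binom-unique x k eq = *-cancelʳ (ι-factorial-nonzero k) (trans eq (sym (binom-factorial x k)))

  binom-zero : ∀ x → binom x 0 ≈ 1#
  binom-zero x = sym (binom-unique x 0 (solve 0 (κ 1 :* (κ 1 :+ κ 0) := κ 1) refl))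

  binom-one : ∀ x → binom x 1 ≈ x
  binom-one x = sym (binom-unique x 1 (solve 1 (λ x → x :* (κ 1 :+ κ 0) := κ 1 :* (x :- κ 0)) refl x))

  binom-step : ∀ x k → binom x (suc k) * ι (suc k) ≈ binom x k * (x - ι k)
  binom-step x k = *-cancelʳ (ι-factorial-nonzero k) (begin
    (binom x (suc k) * ι (suc k)) * ι (k !) ≈⟨ *-assoc _ _ _ ⟩
    binom x (suc k) * (ι (suc k) * ι (k !)) ≈⟨ *-congˡ (sym (ι-* (suc k) (k !))) ⟩
    binom x (suc k) * ι (suc k !)           ≈⟨ binom-factorial x (suc k) ⟩
    falling x k * (x - ι k)                 ≈⟨ *-congʳ (sym (binom-factorial x k)) ⟩
    (binom x k * ι (k !)) * (x - ι k)       ≈⟨ solve 3 (λ b f d → (b :* f) :* d := (b :* d) :* f) refl _ _ _ ⟩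
    (binom x k * (x - ι k)) * ι (k !)       ∎)

  binom-vanish : ∀ {x} n k → x ≈ ι n → n ℕ.< k → binom x k ≈ 0#
  binom-vanish {x} n k x≈n n<k = trans (*-congʳ falling≈0) (zeroˡ _)
    where
    falling≈0 : falling x k ≈ 0#
    falling≈0 = Π-zero k _ n n<k (trans (+-congʳ x≈n) (-‿inverseʳ (ι n)))

  -- binom (-1) k = (-1)^k, in the recursive form the geometric series needs.
  binom-minus-one : ∀ {x} → x ≈ - 1# → ∀ k → binom x (suc k) ≈ - binom x k
  binom-minus-one {x} x≈-1 k = *-cancelʳ (charZero k) (begin
    binom x (suc k) * ι (suc k)  ≈⟨ binom-step x k ⟩
    binom x k * (x - ι k)        ≈⟨ *-congˡ (+-congʳ x≈-1) ⟩
    binom x k * (- 1# - ι k)     ≈⟨ solve 2 (λ b y → b :* (:- κ 1 :- y) := (:- b) :* (κ 1 :+ y)) refl _ _ ⟩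
    - binom x k * ι (suc k)      ∎)

  one-∸ : ∀ {n i} → i ℕ.< n → one (n ∸ i) ≡ 0#
  one-∸ {suc n} {zero}  _         = ≡.refl
  one-∸ {suc n} {suc i} (s≤s i<n) = one-∸ i<n

  ⊛-last : ∀ (X Y : Series) n → (X ⊛ Y) n ≈ Σ< n (λ i → X i * Y (n ∸ i)) + X n * Y 0
  ⊛-last X Y n = +-congˡ (*-congˡ (reflexive (≡.cong Y (ℕₚ.n∸n≡0 n))))

  ⊛-identityʳ : ∀ (X : Series) n → (X ⊛ one) n ≈ X n
  ⊛-identityʳ X n = begin
    (X ⊛ one) n                                ≈⟨ ⊛-last X one n ⟩
    Σ< n (λ i → X i * one (n ∸ i)) + X n * 1#  ≈⟨ +-cong (Σ-zero n (λ i i<n → trans (*-congˡ (reflexive (one-∸ i<n))) (zeroʳ _))) (*-identityʳ _) ⟩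
    0# + X n                                   ≈⟨ +-identityˡ _ ⟩
    X n                                        ∎

  ⊛-distribˡ : ∀ (X Y Z W : Series) → (∀ i → W i ≈ Y i + Z i) → ∀ n → (X ⊛ W) n ≈ (X ⊛ Y) n + (X ⊛ Z) n
  ⊛-distribˡ X Y Z W W≈Y+Z n =
    trans (Σ-cong (suc n) (λ i _ → trans (*-congˡ (W≈Y+Z (n ∸ i))) (distribˡ _ _ _))) (Σ-+ (suc n) _ _)

  inv-inverse : ∀ h → h 0 ≈ 1# → ∀ n → (h ⊛ inv h) n ≈ one n
  inv-inverse h h0≈1 zero    = trans (+-identityˡ _) (trans (*-congʳ h0≈1) (*-identityˡ _))
  inv-inverse h h0≈1 (suc n) = begin
    (h ⊛ inv h) (suc n)                                                  ≈⟨ Σ-head (suc n) _ ⟩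
    h 0 * inv h (suc n) + Σ< (suc n) (λ i → h (suc i) * inv h (n ∸ i))  ≈⟨ +-cong (*-congʳ h0≈1) (Σ-cong (suc n) (λ i i<1+n → *-congˡ (reflexive (≡.sym (invList-at (ℕₚ.≤-pred i<1+n)))))) ⟩
    1# * (- E) + E                                                       ≈⟨ solve 1 (λ e → κ 1 :* (:- e) :+ e := κ 0) refl E ⟩
    0#                                                                   ∎
    where
    E = Σ< (suc n) (λ j → h (suc j) * at (invList h n) j)
    invList-at : ∀ {n j} → j ℕ.≤ n → at (invList h n) j ≡ inv h (n ∸ j)
    invList-at {n}     {zero}  _         = ≡.refl
    invList-at {suc n} {suc j} (s≤s j≤n) = invList-at j≤n

  -- Left inverses of a series u with u 0 = 1 are unique (strong induction
  -- on the index: the n-th coefficient of X ⊛ u determines X n).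
  left-inverse-unique : ∀ (u X Y : Series) → u 0 ≈ 1# →
    (∀ n → (X ⊛ u) n ≈ one n) → (∀ n → (Y ⊛ u) n ≈ one n) → ∀ n → X n ≈ Y n
  left-inverse-unique u X Y u0≈1 X⊛u Y⊛u = <-rec (λ n → X n ≈ Y n) step
    where
    step : ∀ n → (∀ {i} → i ℕ.< n → X i ≈ Y i) → X n ≈ Y n
    step n earlier = begin
      X n             ≈⟨ sym (trans (*-congˡ u0≈1) (*-identityʳ _)) ⟩
      X n * u 0       ≈⟨ +-cancelˡ _ _ _ (begin
        Σ< n (λ i → Y i * u (n ∸ i)) + X n * u 0 ≈⟨ +-congʳ (sym (Σ-cong n (λ i i<n → *-congʳ (earlier i<n)))) ⟩
        Σ< n (λ i → X i * u (n ∸ i)) + X n * u 0 ≈⟨ sym (⊛-last X u n) ⟩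
        (X ⊛ u) n                                ≈⟨ trans (X⊛u n) (sym (Y⊛u n)) ⟩
        (Y ⊛ u) n                                ≈⟨ ⊛-last Y u n ⟩
        Σ< n (λ i → Y i * u (n ∸ i)) + Y n * u 0 ∎) ⟩
      Y n * u 0       ≈⟨ trans (*-congˡ u0≈1) (*-identityʳ _) ⟩
      Y n             ∎

  power-vanish : ∀ (t : Series) → t 0 ≈ 0# → ∀ k i → i ℕ.< k → (t ^^ k) i ≈ 0#
  power-vanish t t0≈0 (suc k) i i<1+k = Σ-zero (suc i) term
    where
    term : ∀ j → j ℕ.< suc i → (t ^^ k) j * t (i ∸ j) ≈ 0#
    term j j≤i with j ℕ.<? k
    ... | yes j<k = trans (*-congʳ (power-vanish t t0≈0 k j j<k)) (zeroˡ _)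
    ... | no  j≮k = trans (*-congˡ (trans (reflexive (≡.cong t (ℕₚ.m≤n⇒m∸n≡0 i≤j))) t0≈0)) (zeroʳ _)
      where
      i≤j : i ℕ.≤ j
      i≤j = ℕₚ.≤-trans (ℕₚ.≤-pred i<1+k) (ℕₚ.≮⇒≥ j≮k)

  -- The geometric series: for u with u 0 = 1 and t = u - 1, the series
  -- S = Σ_k cf k t^k with cf k = (-1)^k is a left inverse of u.  The sum
  -- defining the n-th coefficient is finite because t^k has order k.
  module GeometricSeries (cf : ℕ → Carrier) (cf-zero : cf 0 ≈ 1#) (cf-suc : ∀ k → cf (suc k) ≈ - cf k)
                         (u : Series) (u0≈1 : u 0 ≈ 1#) where
    t : Series
    t = u ⊖ one

    t0≈0 : t 0 ≈ 0#
    t0≈0 = trans (+-congʳ u0≈1) (-‿inverseʳ 1#)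

    S : Series
    S n = Σ< (suc n) (λ k → cf k * (t ^^ k) n)

    -- Terms with k > n vanish, so the n-th coefficient may sum over any k < N.
    S-extend : ∀ N n → n ℕ.< N → S n ≈ Σ< N (λ k → cf k * (t ^^ k) n)
    S-extend N n n<N = sym (Σ-extend _ n<N (λ k n<k → trans (*-congˡ (power-vanish t t0≈0 k n n<k)) (zeroʳ _)))

    S⊛t : ∀ n → (S ⊛ t) n ≈ Σ< (suc n) (λ k → cf k * (t ^^ suc k) n)
    S⊛t n = begin
      Σ< (suc n) (λ i → S i * t (n ∸ i))
        ≈⟨ Σ-cong (suc n) (λ i i≤n → trans (*-congʳ (S-extend (suc n) i i≤n)) (Σ-*ʳ (suc n) _ _)) ⟩
      Σ< (suc n) (λ i → Σ< (suc n) (λ k → (cf k * (t ^^ k) i) * t (n ∸ i)))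
        ≈⟨ Σ-swap (suc n) (suc n) _ ⟩
      Σ< (suc n) (λ k → Σ< (suc n) (λ i → (cf k * (t ^^ k) i) * t (n ∸ i)))
        ≈⟨ Σ-cong (suc n) (λ k _ → trans (Σ-cong (suc n) (λ i _ → *-assoc _ _ _)) (sym (Σ-*ˡ (suc n) _ _))) ⟩
      Σ< (suc n) (λ k → cf k * (t ^^ suc k) n) ∎

    -- Telescoping: S ⊛ u = S + S ⊛ t = one.
    S⊛u : ∀ n → (S ⊛ u) n ≈ one n
    S⊛u n = begin
      (S ⊛ u) n                         ≈⟨ ⊛-distribˡ S one t u (λ i → solve 2 (λ a b → a := b :+ (a :- b)) refl (u i) (one i)) n ⟩
      (S ⊛ one) n + (S ⊛ t) n           ≈⟨ +-cong (⊛-identityʳ S n) (S⊛t n) ⟩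
      S n + Σ< (suc n) (λ k → cf k * (t ^^ suc k) n)
        ≈⟨ +-cong S-head (trans (Σ-cong (suc n) (λ k _ → trans (*-congʳ (sym (alternate k))) (sym (-‿distribˡ-* _ _)))) (sym (Σ-neg (suc n) _))) ⟩
      (cf 0 * one n + E) + - E          ≈⟨ solve 2 (λ a e → (a :+ e) :+ :- e := a) refl (cf 0 * one n) E ⟩
      cf 0 * one n                      ≈⟨ trans (*-congʳ cf-zero) (*-identityˡ _) ⟩
      one n                             ∎
      where
      E : Carrier
      E = Σ< (suc n) (λ k → cf (suc k) * (t ^^ suc k) n)
      alternate : ∀ k → - cf (suc k) ≈ cf k
      alternate k = trans (-‿cong (cf-suc k)) (-‿involutive _)
      S-head : S n ≈ cf 0 * one n + E
      S-head = trans (S-extend (suc (suc n)) n (ℕₚ.m<n⇒m<1+n (ℕₚ.n<1+n n))) (Σ-head (suc n) _)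

  -- (x / g)^(-1) = g / x: the binomial series at exponent -1 is the
  -- geometric series, hence the inverse of x / g = inv (g / x).
  cpow-minus-one : ∀ g s → g 1 ≈ 1# → s ≈ - 1# → ∀ m → cpow (xOver g) s m ≈ g (suc m)
  cpow-minus-one g s g1≈1 s≈-1 =
    left-inverse-unique (xOver g) (cpow (xOver g) s) (divX g) refl
      Geometric.S⊛u (inv-inverse (divX g) g1≈1)
    where
    module Geometric = GeometricSeries (binom s) (binom-zero s) (binom-minus-one s≈-1) (xOver g) refl

  q-zero : ∀ f s → q f s 0 ≈ 1#
  q-zero f s = trans (solve 1 (λ b → (κ 1 :+ κ 0) :* (κ 0 :+ b :* κ 1) := b) refl (binom s 0)) (binom-zero s)

  q-one : ∀ f s → q f s 1 ≈ - (s * f 2)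
  q-one f s = begin
    q f s 1 ≈⟨ solve 3 (λ b₀ b₁ a →
                 (κ 1 :+ κ 0) :* ((κ 0 :+ b₀ :* κ 0)
                   :+ b₁ :* ((κ 0 :+ κ 1 :* ((:- (κ 0 :+ a :* κ 1)) :- κ 0)) :+ κ 0 :* (κ 1 :- κ 1)))
                 := :- (b₁ :* a)) refl (binom s 0) (binom s 1) (f 2) ⟩
    - (binom s 1 * f 2) ≈⟨ -‿cong (*-congʳ (binom-one s)) ⟩
    - (s * f 2) ∎

  two : Carrier
  two = 1# + 1#

  p-two-zero : ∀ f → p f two 0 ≈ 1#
  p-two-zero f = trans (*-cong (binom-zero (two - 1#)) (q-zero f two)) (*-identityˡ 1#)

  p-two-one : ∀ f → p f two 1 ≈ - (two * f 2)
  p-two-one f = begin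
    binom (two - 1#) 1 * q f two 1 ≈⟨ *-cong (binom-one _) (q-one f two) ⟩
    (two - 1#) * - (two * f 2)     ≈⟨ solve 1 (λ a → ((κ 1 :+ κ 1) :- κ 1) :* a := a) refl _ ⟩
    - (two * f 2)                  ∎

  p-two-vanish : ∀ f n → p f two (suc (suc n)) ≈ 0#
  p-two-vanish f n = trans (*-congʳ (binom-vanish 1 (suc (suc n)) two-1≈ι1 (s≤s (s≤s ℕ.z≤n)))) (zeroˡ _)
    where
    two-1≈ι1 : two - 1# ≈ ι 1
    two-1≈ι1 = solve 0 ((κ 1 :+ κ 1) :- κ 1 := κ 1 :+ κ 0) refl

  -- ρ m = (-2)(-3)⋯(-(m+1)) = falling (-2) m.
  ρ : ℕ → Carrier
  ρ m = Π< m (λ i → - ι (suc (suc i)))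

  ρ-nonzero : ∀ m → ¬ (ρ m ≈ 0#)
  ρ-nonzero m = Π-nonzero m _ (λ i -ι≈0 → charZero (suc i) (-‿injective (trans -ι≈0 (sym -0#≈0#))))

  p-minus-one : ∀ g → g 1 ≈ 1# → ∀ m → p g (1# - two) m ≈ ρ m * g (suc m)
  p-minus-one g g1≈1 m = begin
    binom (s′ - 1#) m * (ι (m !) * cpow (xOver g) s′ m) ≈⟨ sym (*-assoc _ _ _) ⟩
    (binom (s′ - 1#) m * ι (m !)) * cpow (xOver g) s′ m ≈⟨ *-cong (binom-factorial _ m) (cpow-minus-one g s′ g1≈1 s′≈-1 m) ⟩
    falling (s′ - 1#) m * g (suc m)                     ≈⟨ *-congʳ (Π-cong m factor) ⟩
    ρ m * g (suc m)                                     ∎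
    where
    s′ = 1# - two
    s′≈-1 : s′ ≈ - 1#
    s′≈-1 = solve 0 (κ 1 :- (κ 1 :+ κ 1) := :- κ 1) refl
    factor : ∀ i → (s′ - 1#) - ι i ≈ - ι (suc (suc i))
    factor i = solve 1 (λ y → (κ 1 :- (κ 1 :+ κ 1)) :- κ 1 :- y := :- (κ 1 :+ (κ 1 :+ y))) refl (ι i)

  -- The coefficient of α^{-k} in p_2^f p_{-1}^g: only the first two
  -- coefficients of p_2^f contribute, and ρ k factors out.
  pp-two : ∀ f g → g 1 ≈ 1# → ∀ k →
    pp f g two (suc k) ≈ ρ k * - (ι (suc (suc k)) * g (suc (suc k)) + (two * f 2) * g (suc k))
  pp-two f g g1≈1 k = begin
    pp f g two (suc k)
      ≈⟨ trans (Σ-head (suc k) _) (+-congˡ (Σ-head k _)) ⟩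
    p f two 0 * p g s′ (suc k) + (p f two 1 * p g s′ k + Σ< k (λ n → p f two (suc (suc n)) * p g s′ (k ∸ suc n)))
      ≈⟨ +-cong (*-cong (p-two-zero f) (p-minus-one g g1≈1 (suc k)))
                (+-cong (*-cong (p-two-one f) (p-minus-one g g1≈1 k))
                        (Σ-zero k (λ n _ → trans (*-congʳ (p-two-vanish f n)) (zeroˡ _)))) ⟩
    1# * ((ρ k * - A) * g (suc (suc k))) + (- (two * f 2) * (ρ k * g (suc k)) + 0#)
      ≈⟨ solve 5 (λ r a b c d → κ 1 :* ((r :* (:- a)) :* b) :+ ((:- (c)) :* (r :* d) :+ κ 0)
                                := r :* (:- (a :* b :+ c :* d))) refl (ρ k) A (g (suc (suc k))) (two * f 2) (g (suc k)) ⟩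
    ρ k * - (A * g (suc (suc k)) + (two * f 2) * g (suc k)) ∎
    where
    s′ = 1# - two
    A = ι (suc (suc k))

  -- Comparing the coefficients of α^{-k} in the hypothesis at s = 2 and
  -- cancelling ρ k ≠ 0 gives, for every k,
  -- (k+2) f_{k+2} + 2 g₂ f_{k+1} = (k+2) g_{k+2} + 2 f₂ g_{k+1}.
  coefficient-relation : ∀ f g → f 1 ≈ 1# → g 1 ≈ 1# →
    ((s : Carrier) (k : ℕ) → pp f g s k ≈ pp g f s k) → ∀ k →
    ι (suc (suc k)) * f (suc (suc k)) + (two * g 2) * f (suc k) ≈
    ι (suc (suc k)) * g (suc (suc k)) + (two * f 2) * g (suc k)
  coefficient-relation f g f1≈1 g1≈1 symmetric k =
    sym (-‿injective (*-cancelˡ (ρ-nonzero k) (begin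
      ρ k * - _ ≈⟨ sym (pp-two f g g1≈1 k) ⟩
      pp f g two (suc k) ≈⟨ symmetric two (suc k) ⟩
      pp g f two (suc k) ≈⟨ pp-two g f f1≈1 k ⟩
      ρ k * - _ ∎)))

  derivative-at-zero : ∀ f → Normalized f → ∀ c → deriv f 0 + c * f 0 ≈ 1#
  derivative-at-zero f (f0≈0 , f1≈1) c = begin
    ι 1 * f 1 + c * f 0 ≈⟨ +-cong (*-congˡ f1≈1) (*-congˡ f0≈0) ⟩
    ι 1 * 1# + c * 0#   ≈⟨ solve 1 (λ c → (κ 1 :+ κ 0) :* κ 1 :+ c :* κ 0 := κ 1) refl c ⟩
    1#                  ∎

  second-derivative-at-zero : ∀ f → deriv (deriv f) 0 ≈ two * f 2
  second-derivative-at-zero f = solve 1 (λ a → (κ 1 :+ κ 0) :* ((κ 1 :+ (κ 1 :+ κ 0)) :* a) := (κ 1 :+ κ 1) :* a) refl (f 2)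

proposition2p6 : {c ℓ : Level} (K : CharZeroField c ℓ) →
    let open CharZeroField K
        open PowerSeries K
    in
    (f g : Series) → Normalized f → Normalized g →
    ((s : Carrier) (k : ℕ) → pp f g s k ≈ pp g f s k) →
    (n : ℕ) →
    deriv f n + deriv (deriv g) 0 * f n ≈ deriv g n + deriv (deriv f) 0 * g n
proposition2p6 K f g f-normal g-normal symmetric zero =
  trans (derivative-at-zero f f-normal _) (sym (derivative-at-zero g g-normal _))
  where open CharZeroField K; open Proof K
proposition2p6 K f g (_ , f1≈1) (_ , g1≈1) symmetric (suc k) = begin
  deriv f (suc k) + deriv (deriv g) 0 * f (suc k)    ≈⟨ +-congˡ (*-congʳ (second-derivative-at-zero g)) ⟩
  ι (2 ℕ.+ k) * f (2 ℕ.+ k) + (two * g 2) * f (suc k) ≈⟨ coefficient-relation f g f1≈1 g1≈1 symmetric k ⟩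
  ι (2 ℕ.+ k) * g (2 ℕ.+ k) + (two * f 2) * g (suc k) ≈⟨ +-congˡ (*-congʳ (sym (second-derivative-at-zero f))) ⟩
  deriv g (suc k) + deriv (deriv f) 0 * g (suc k)    ∎
  where
  open CharZeroField K
  open PowerSeries K
  open Proof K
  open import Relation.Binary.Reasoning.Setoid setoid
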